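{- Let $N$ be a friend of $10$. If a Fermat prime $F_k=2^{2^k}+1$ (with $k\ge 0$ an integer) divides $N$, then there exists a prime factor $p$ of $N$ such that $p\equiv 1\pmod{2F_k}$.
   Context: For a positive integer $n$, $\sigma(n)$ denotes the sum of the positive divisors of $n$ and $I(n)=\sigma(n)/n$. A positive integer $N>10$ is called a friend of $10$ if $I(N)=9/5$. -}

module Defs where

open import Data.Nat using (ℕ; suc; _+_; _*_; _^_; NonZero)
open import Data.Nat.Divisibility using (_∣?_)
open import Data.List using (List; filter; upTo; map)
open import Data.Nat.ListAction using (sum)
open import Data.Integer using (+_)
open import Data.Rational using (ℚ; _/_)

divisors : ℕ → List ℕ
divisors n = filter (_∣? n) (map suc (upTo n))

σ : ℕ → ℕ
σ n = sum (divisors n)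

I : (n : ℕ) → .{{NonZero n}} → ℚ
I n = (+ σ n) / n

FriendOf10 : (N : ℕ) → .{{NonZero N}} → Set
FriendOf10 N = (10 Data.Nat.< N) Data.Product.× (I N ≡ (+ 9) / 5)
  where open import Relation.Binary.PropositionalEquality using (_≡_)
        import Data.Product

F : ℕ → ℕ
F k = 2 ^ (2 ^ k) + 1

-- Write N = 5g with σ(N) = 9g. N is odd: otherwise N = 10t with t > 1, and then
-- σ(N) ≥ 10t + 5t + 2t + t + 1 > 18t = σ(N). Hence g and σ(N) are odd as well.
-- Suppose that no prime factor q of N satisfies q ≡ 1 (mod 2F), where F = F_k. For q^a ∥ N the factor
-- σ(q^a) = 1 + q + ⋯ + q^a of σ(N) is odd, so a is even. If F ∣ σ(q^a) then q ≠ F, q^(a+1) ≡ 1 (mod F), and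
-- Fermat's little theorem gives q^(2^(2^k)) ≡ 1 (mod F); as a + 1 is odd this forces q ≡ 1 (mod F), and since
-- q is odd, q ≡ 1 (mod 2F). So F ∤ σ(N) = 9g, hence F ∤ g, and F ∣ 5g forces F = 5; but then
-- σ(N) = σ(5) σ(g) = 6 σ(g) is even. The prime is then found by a finite search among the divisors of N.

module Submission where

open import Defs
open import Data.Nat
open import Data.Nat.Properties
open import Data.Nat.Divisibility
open import Data.Nat.Tactic.RingSolver using (solve-∀)
open import Data.Nat.Coprimality using (Coprime; coprime-divisor)
open import Data.Nat.GCD using (gcd)
open import Data.Nat.Primality.Factorisation using (factorise)
open import Data.Nat.Induction using (<-rec)
open import Data.Nat.Primality using (Prime; prime; prime?; prime[2]; euclidsLemma; prime⇒irreducible; prime⇒nonZero; ¬prime[0]; ¬prime[1])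
open import Data.Nat.DivMod using (_%_; _/_; %-distribˡ-+; %-distribˡ-*; %-remove-+ˡ; %-remove-+ʳ; m≡m%n+[m/n]*n; m/n*n≡m)
open import Data.Nat.Combinatorics using (_C_; nCk≡n!/k![n-k]!; k![n∸k]!∣n!; nCn≡1)
open import Data.Nat.ListAction using (sum; product)
open import Data.Nat.ListAction.Properties using (sum-++)
open import Data.Bool using (T; if_then_else_)
open import Data.List using (List; []; _∷_; filter; upTo; map; _∷ʳ_)
open import Data.List.Properties using (upTo-∷ʳ; map-++)
open import Data.List.Relation.Unary.All as All using (All; []; _∷_)
open import Data.Fin as Fin using (Fin; toℕ; fromℕ; fromℕ<)
open import Data.Fin.Properties using (toℕ-fromℕ; toℕ-fromℕ<; toℕ-inject₁; toℕ<n; any?)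
open import Data.Vec.Functional using (Vector; init; tail; last)
open import Data.Product using (Σ; Σ-syntax; _×_; _,_)
open import Data.Sum using (inj₁; inj₂; [_,_]′)
open import Data.Parity as ℙ using (0ℙ; 1ℙ; _⁻¹)
open import Data.Parity.Properties using (+-homo-+; *-homo-*; suc-homo-⁻¹)
import Data.Integer as ℤ
import Data.Integer.Properties as ℤ
import Data.Rational as ℚ
open import Data.Rational.Properties using (↥-/; ↧-/)
open import Function using (id; _∘_; _∘₂_)
open import Level using (0ℓ)
open import Relation.Nullary using (¬_; yes; no; does; contradiction)
open import Relation.Nullary.Decidable using (Dec; dec-true; dec-false; does-⇔; ¬?; _×-dec_; from-yes; from-no)
open import Function.Bundles using (mk⇔)
open import Relation.Unary using (Pred; Decidable)
open import Relation.Binary.PropositionalEquality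
open import Algebra.Properties.CommutativeSemigroup +-commutativeSemigroup using (interchange)
open import Algebra.Properties.CommutativeSemiring.Binomial +-*-commutativeSemiring using (theorem; binomialTerm)
open import Algebra.Definitions.RawSemiring +-*-rawSemiring using () renaming (_^_ to _^ₛ_; _×_ to _×ₛ_)
open import Algebra.Properties.Monoid.Sum +-0-monoid using () renaming (sum to ∑; sum-init-last to ∑-init-last; sum-cong-≗ to ∑-cong-≗)

sumTo : ℕ → (ℕ → ℕ) → ℕ
sumTo zero    f = 0
sumTo (suc n) f = sumTo n f + f (suc n)

module _ {P : Pred ℕ 0ℓ} (P? : Decidable P) where

  restrictTo : (ℕ → ℕ) → ℕ → ℕ
  restrictTo f d = if does (P? d) then f d else 0

  restrictTo-∈ : ∀ f {d} → P d → restrictTo f d ≡ f d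
  restrictTo-∈ f {d} Pd = cong (if_then f d else 0) (dec-true (P? d) Pd)

  restrictTo-∉ : ∀ f {d} → ¬ P d → restrictTo f d ≡ 0
  restrictTo-∉ f {d} ¬Pd = cong (if_then f d else 0) (dec-false (P? d) ¬Pd)

  sum-filter : ∀ xs → sum (filter P? xs) ≡ sum (map (restrictTo id) xs)
  sum-filter []       = refl
  sum-filter (x ∷ xs) with P? x
  ... | yes _ = cong (x +_) (sum-filter xs)
  ... | no  _ = sum-filter xs

sum-map-suc-upTo : ∀ f n → sum (map f (map suc (upTo n))) ≡ sumTo n f
sum-map-suc-upTo f zero    = refl
sum-map-suc-upTo f (suc n) = begin
  sum (map f (map suc (upTo (suc n))))              ≡⟨ cong (sum ∘ map f ∘ map suc) (upTo-∷ʳ n) ⟨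
  sum (map f (map suc (upTo n ∷ʳ n)))               ≡⟨ cong (sum ∘ map f) (map-++ suc (upTo n) _) ⟩
  sum (map f (map suc (upTo n) ∷ʳ suc n))           ≡⟨ cong sum (map-++ f (map suc (upTo n)) _) ⟩
  sum (map f (map suc (upTo n)) ∷ʳ f (suc n))       ≡⟨ sum-++ (map f (map suc (upTo n))) _ ⟩
  sum (map f (map suc (upTo n))) + (f (suc n) + 0)  ≡⟨ cong₂ _+_ (sum-map-suc-upTo f n) (+-identityʳ _) ⟩
  sumTo n f + f (suc n)                             ∎
  where open ≡-Reasoning

sumTo-cong : ∀ n {f g} → (∀ {d} → 0 < d → d ≤ n → f d ≡ g d) → sumTo n f ≡ sumTo n g
sumTo-cong zero    f≡g = refl
sumTo-cong (suc n) f≡g = cong₂ _+_ (sumTo-cong n (λ 0<d d≤n → f≡g 0<d (m≤n⇒m≤1+n d≤n))) (f≡g z<s ≤-refl)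

sumTo-zero : ∀ n {f} → (∀ {d} → 0 < d → d ≤ n → f d ≡ 0) → sumTo n f ≡ 0
sumTo-zero zero    f≡0 = refl
sumTo-zero (suc n) f≡0 = cong₂ _+_ (sumTo-zero n (λ 0<d d≤n → f≡0 0<d (m≤n⇒m≤1+n d≤n))) (f≡0 z<s ≤-refl)

sumTo-distrib-+ : ∀ n f g → sumTo n (λ d → f d + g d) ≡ sumTo n f + sumTo n g
sumTo-distrib-+ zero    f g = refl
sumTo-distrib-+ (suc n) f g =
  trans (cong (_+ (f (suc n) + g (suc n))) (sumTo-distrib-+ n f g))
        (interchange (sumTo n f) (sumTo n g) (f (suc n)) (g (suc n)))

*-distribˡ-sumTo : ∀ c n f → c * sumTo n f ≡ sumTo n (λ d → c * f d)
*-distribˡ-sumTo c zero    f = *-zeroʳ c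
*-distribˡ-sumTo c (suc n) f =
  trans (*-distribˡ-+ c (sumTo n f) (f (suc n))) (cong (_+ c * f (suc n)) (*-distribˡ-sumTo c n f))

sumTo-+ : ∀ m n f → sumTo (m + n) f ≡ sumTo m f + sumTo n (λ d → f (m + d))
sumTo-+ m zero    f = trans (cong (λ k → sumTo k f) (+-identityʳ m)) (sym (+-identityʳ _))
sumTo-+ m (suc n) f rewrite +-suc m n =
  trans (cong (_+ f (suc (m + n))) (sumTo-+ m n f)) (+-assoc (sumTo m f) _ _)

sumTo-split : ∀ {P : Pred ℕ 0ℓ} (P? : Decidable P) n f →
              sumTo n f ≡ sumTo n (restrictTo P? f) + sumTo n (restrictTo (¬? ∘ P?) f)
sumTo-split P? n f = trans (sumTo-cong n (λ {d} _ _ → split d)) (sumTo-distrib-+ n _ _)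
  where
  split : ∀ d → f d ≡ restrictTo P? f d + restrictTo (¬? ∘ P?) f d
  split d with P? d
  ... | yes _ = sym (+-identityʳ (f d))
  ... | no  _ = refl

sumTo-multiples : ∀ p .{{_ : NonZero p}} m g → sumTo (p * m) (restrictTo (p ∣?_) g) ≡ sumTo m (g ∘ (p *_))
sumTo-multiples p zero    g rewrite *-zeroʳ p = refl
sumTo-multiples p@(suc p-1) (suc m) g = begin
  sumTo (p * suc m) h                                ≡⟨ cong (λ k → sumTo k h) (trans (*-suc p m) (+-comm p (p * m))) ⟩
  sumTo (p * m + p) h                                ≡⟨ sumTo-+ (p * m) p h ⟩
  sumTo (p * m) h + sumTo p (λ j → h (p * m + j))    ≡⟨ cong₂ _+_ (sumTo-multiples p m g) lastBlock ⟩
  sumTo m (g ∘ (p *_)) + g (p * suc m)               ∎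
  where
  open ≡-Reasoning
  h = restrictTo (p ∣?_) g
  p∤ : ∀ {j} → 0 < j → j ≤ p-1 → ¬ p ∣ p * m + j
  p∤ 0<j j≤p-1 p∣ = <⇒≱ (s≤s j≤p-1) (∣⇒≤ {{>-nonZero 0<j}} (∣m+n∣m⇒∣n p∣ (m∣m*n m)))
  lastBlock : sumTo p (λ j → h (p * m + j)) ≡ g (p * suc m)
  lastBlock = begin
    sumTo p-1 (λ j → h (p * m + j)) + h (p * m + p)  ≡⟨ cong (_+ h (p * m + p)) (sumTo-zero p-1 (restrictTo-∉ (p ∣?_) g ∘₂ p∤)) ⟩
    h (p * m + p)                                    ≡⟨ restrictTo-∈ (p ∣?_) g (∣m∣n⇒∣m+n (m∣m*n m) ∣-refl) ⟩
    g (p * m + p)                                    ≡⟨ cong g (trans (+-comm (p * m) p) (sym (*-suc p m))) ⟩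
    g (p * suc m)                                    ∎

ifDivides : ℕ → ℕ → ℕ
ifDivides n = restrictTo (_∣? n) id

σ≡sumTo : ∀ n → σ n ≡ sumTo n (ifDivides n)
σ≡sumTo n = trans (sum-filter (_∣? n) (map suc (upTo n))) (sum-map-suc-upTo (ifDivides n) n)

ifDivides-cong : ∀ {a b d} → (d ∣ a → d ∣ b) → (d ∣ b → d ∣ a) → ifDivides a d ≡ ifDivides b d
ifDivides-cong {a} {b} {d} a⇒b b⇒a = cong (if_then d else 0) (does-⇔ (mk⇔ a⇒b b⇒a) (d ∣? a) (d ∣? b))

ifDivides-* : ∀ p .{{_ : NonZero p}} n e → ifDivides (p * n) (p * e) ≡ p * ifDivides n e
ifDivides-* p n e with e ∣? n
... | yes e∣n = restrictTo-∈ (_∣? p * n) id (*-monoʳ-∣ p e∣n)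
... | no  e∤n = trans (restrictTo-∉ (_∣? p * n) id (e∤n ∘ *-cancelˡ-∣ p)) (sym (*-zeroʳ p))

sumTo-ifDivides : ∀ {m n} .{{_ : NonZero m}} → m ≤ n → sumTo n (ifDivides m) ≡ σ m
sumTo-ifDivides {m} {n} m≤n = begin
  sumTo n (ifDivides m)                                              ≡⟨ cong (λ k → sumTo k (ifDivides m)) (m+[n∸m]≡n m≤n) ⟨
  sumTo (m + (n ∸ m)) (ifDivides m)                                  ≡⟨ sumTo-+ m (n ∸ m) (ifDivides m) ⟩
  sumTo m (ifDivides m) + sumTo (n ∸ m) (λ d → ifDivides m (m + d))  ≡⟨ cong (sumTo m (ifDivides m) +_) (sumTo-zero (n ∸ m) beyond) ⟩
  sumTo m (ifDivides m) + 0                                          ≡⟨ +-identityʳ _ ⟩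
  sumTo m (ifDivides m)                                              ≡⟨ σ≡sumTo m ⟨
  σ m                                                                ∎
  where
  open ≡-Reasoning
  beyond : ∀ {d} → 0 < d → d ≤ n ∸ m → ifDivides m (m + d) ≡ 0
  beyond {d} 0<d _ = restrictTo-∉ (_∣? m) id (λ m+d∣m → <⇒≱ (m<m+n m 0<d) (∣⇒≤ m+d∣m))

prime∤1 : ∀ {p} → Prime p → ¬ p ∣ 1
prime∤1 pp p∣1 = ¬prime[1] (subst Prime (∣1⇒≡1 p∣1) pp)

prime>1 : ∀ {p} → Prime p → 1 < p
prime>1 {p} (prime {{p>1}} _) = nonTrivial⇒n>1 p {{p>1}}

prime∤⇒coprime : ∀ {p d} → Prime p → ¬ p ∣ d → Coprime d p
prime∤⇒coprime pp p∤d (i∣d , i∣p) with prime⇒irreducible pp i∣p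
... | inj₁ i≡1 = i≡1
... | inj₂ refl = contradiction i∣d p∤d

coprime-divisor-^ : ∀ {d p m} → Coprime d p → ∀ k → d ∣ p ^ k * m → d ∣ m
coprime-divisor-^ {d} {m = m} _ zero d∣ = subst (d ∣_) (*-identityˡ m) d∣
coprime-divisor-^ {d} {p} {m} d⊥p (suc k) d∣ =
  coprime-divisor-^ d⊥p k (coprime-divisor d⊥p (subst (d ∣_) (*-assoc p (p ^ k) m) d∣))

-- The divisors of p^(1+a) m that are multiples of p are p times the divisors of p^a m; the others are
-- exactly the divisors of m.
σ-prime-power-step : ∀ {p m} → Prime p → ¬ p ∣ m → .{{_ : NonZero m}} → ∀ a →
                     σ (p ^ suc a * m) ≡ σ m + p * σ (p ^ a * m)
σ-prime-power-step {p} {m} pp p∤m a = begin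
  σ N                                                                      ≡⟨ σ≡sumTo N ⟩
  sumTo N (ifDivides N)                                                    ≡⟨ sumTo-split (p ∣?_) N (ifDivides N) ⟩
  sumTo N (restrictTo (p ∣?_) (ifDivides N)) + sumTo N (restrictTo (¬? ∘ (p ∣?_)) (ifDivides N))
    ≡⟨ cong₂ _+_ multiples (sumTo-cong N (λ {d} _ _ → nonMultiple d)) ⟩
  p * σ n + sumTo N (ifDivides m)                                          ≡⟨ cong (p * σ n +_) (sumTo-ifDivides m≤N) ⟩
  p * σ n + σ m                                                            ≡⟨ +-comm (p * σ n) (σ m) ⟩
  σ m + p * σ n                                                            ∎
  where
  open ≡-Reasoning
  instance _ = prime⇒nonZero pp
  n = p ^ a * m
  N = p ^ suc a * m
  N≡p*n : N ≡ p * n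
  N≡p*n = *-assoc p (p ^ a) m
  m∣N : m ∣ N
  m∣N = n∣m*n (p ^ suc a)
  m≤N : m ≤ N
  m≤N = ∣⇒≤ {{m*n≢0 (p ^ suc a) m {{m^n≢0 p (suc a)}}}} m∣N
  multiples : sumTo N (restrictTo (p ∣?_) (ifDivides N)) ≡ p * σ n
  multiples = begin
    sumTo N (restrictTo (p ∣?_) (ifDivides N))        ≡⟨ cong (λ k → sumTo k (restrictTo (p ∣?_) (ifDivides N))) N≡p*n ⟩
    sumTo (p * n) (restrictTo (p ∣?_) (ifDivides N))  ≡⟨ sumTo-multiples p n (ifDivides N) ⟩
    sumTo n (λ e → ifDivides N (p * e))               ≡⟨ sumTo-cong n (λ {e} _ _ → trans (cong (λ k → ifDivides k (p * e)) N≡p*n)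
                                                                                     (ifDivides-* p n e)) ⟩
    sumTo n (λ e → p * ifDivides n e)                 ≡⟨ *-distribˡ-sumTo p n (ifDivides n) ⟨
    p * sumTo n (ifDivides n)                         ≡⟨ cong (p *_) (σ≡sumTo n) ⟨
    p * σ n                                           ∎
  nonMultiple : ∀ d → restrictTo (¬? ∘ (p ∣?_)) (ifDivides N) d ≡ ifDivides m d
  nonMultiple d with p ∣? d
  ... | yes p∣d = sym (restrictTo-∉ (_∣? m) id (p∤m ∘ ∣-trans p∣d))
  ... | no  p∤d =
    ifDivides-cong (coprime-divisor-^ (prime∤⇒coprime pp p∤d) (suc a)) (λ d∣m → ∣-trans d∣m m∣N)

geometricSum : ℕ → ℕ → ℕ
geometricSum q zero    = 1
geometricSum q (suc a) = 1 + q * geometricSum q a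

geometricSum*pred+1≡^ : ∀ t a → geometricSum (suc t) a * t + 1 ≡ suc t ^ suc a
geometricSum*pred+1≡^ t zero    = base t
  where
  base : ∀ t → 1 * t + 1 ≡ (1 + t) * 1
  base = solve-∀
geometricSum*pred+1≡^ t (suc a) =
  trans (step t (geometricSum (suc t) a)) (cong (suc t *_) (geometricSum*pred+1≡^ t a))
  where
  step : ∀ t g → (1 + (1 + t) * g) * t + 1 ≡ (1 + t) * (g * t + 1)
  step = solve-∀

σ[p^a*m]≡geometricSum*σ[m] : ∀ {p m} → Prime p → ¬ p ∣ m → .{{_ : NonZero m}} → ∀ a →
                             σ (p ^ a * m) ≡ geometricSum p a * σ m
σ[p^a*m]≡geometricSum*σ[m] {m = m} _ _ zero = trans (cong σ (*-identityˡ m)) (sym (+-identityʳ (σ m)))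
σ[p^a*m]≡geometricSum*σ[m] {p} {m} pp p∤m (suc a) = begin
  σ (p ^ suc a * m)                        ≡⟨ σ-prime-power-step pp p∤m a ⟩
  σ m + p * σ (p ^ a * m)                  ≡⟨ cong (λ x → σ m + p * x) (σ[p^a*m]≡geometricSum*σ[m] pp p∤m a) ⟩
  σ m + p * (geometricSum p a * σ m)       ≡⟨ cong (σ m +_) (*-assoc p (geometricSum p a) (σ m)) ⟨
  geometricSum p (suc a) * σ m             ∎
  where open ≡-Reasoning

∣q∧∣geometricSum⇒∣1 : ∀ {d q} a → d ∣ q → d ∣ geometricSum q a → d ∣ 1
∣q∧∣geometricSum⇒∣1 zero    _   d∣1   = d∣1
∣q∧∣geometricSum⇒∣1 {d} {q} (suc a) d∣q d∣sum =
  ∣m+n∣m⇒∣n (subst (d ∣_) (+-comm 1 (q * geometricSum q a)) d∣sum) (∣m⇒∣m*n (geometricSum q a) d∣q)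

parity≡0ℙ⇒2∣ : ∀ n → parity n ≡ 0ℙ → 2 ∣ n
parity≡0ℙ⇒2∣ zero          _      = 2 ∣0
parity≡0ℙ⇒2∣ (suc (suc n)) even-n = ∣m∣n⇒∣m+n (∣-refl {2}) (parity≡0ℙ⇒2∣ n even-n)

¬2∣⇒parity≡1ℙ : ∀ {n} → ¬ 2 ∣ n → parity n ≡ 1ℙ
¬2∣⇒parity≡1ℙ {n} 2∤n with parity n in eq
... | 0ℙ = contradiction (parity≡0ℙ⇒2∣ n eq) 2∤n
... | 1ℙ = refl

2∤⇒2∣pred : ∀ {q} → ¬ 2 ∣ q → 2 ∣ q ∸ 1
2∤⇒2∣pred {zero}  2∤0    = contradiction (2 ∣0) 2∤0
2∤⇒2∣pred {suc t} 2∤1+t  =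
  parity≡0ℙ⇒2∣ t (trans (sym (suc-homo-⁻¹ t)) (cong _⁻¹ (¬2∣⇒parity≡1ℙ 2∤1+t)))

divisor-2∤ : ∀ {x y} → x ∣ y → ¬ 2 ∣ y → ¬ 2 ∣ x
divisor-2∤ x∣y 2∤y 2∣x = 2∤y (∣-trans 2∣x x∣y)

2∤* : ∀ {m n} → ¬ 2 ∣ m → ¬ 2 ∣ n → ¬ 2 ∣ m * n
2∤* {m} {n} 2∤m 2∤n = [ 2∤m , 2∤n ]′ ∘ euclidsLemma m n prime[2]

2∤m∧m∣x∧2∣x⇒2*m∣x : ∀ {m x} → ¬ 2 ∣ m → m ∣ x → 2 ∣ x → 2 * m ∣ x
2∤m∧m∣x∧2∣x⇒2*m∣x {m} 2∤m (divides c refl) 2∣c*m with euclidsLemma c m prime[2] 2∣c*m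
... | inj₁ 2∣c = *-monoˡ-∣ m 2∣c
... | inj₂ 2∣m = contradiction 2∣m 2∤m

parity-geometricSum : ∀ {q} → parity q ≡ 1ℙ → ∀ a → parity (geometricSum q a) ≡ parity (suc a)
parity-geometricSum q-odd zero    = refl
parity-geometricSum {q} q-odd (suc a) = begin
  parity (1 + q * geometricSum q a)                      ≡⟨ +-homo-+ 1 (q * geometricSum q a) ⟩
  1ℙ ℙ.+ parity (q * geometricSum q a)                   ≡⟨ cong (1ℙ ℙ.+_) (*-homo-* q (geometricSum q a)) ⟩
  1ℙ ℙ.+ (parity q ℙ.* parity (geometricSum q a))        ≡⟨ cong₂ (λ x y → 1ℙ ℙ.+ (x ℙ.* y)) q-odd (parity-geometricSum q-odd a) ⟩
  1ℙ ℙ.+ parity (suc a)                                  ≡⟨ +-homo-+ 1 (suc a) ⟨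
  parity (suc (suc a))                                   ∎
  where open ≡-Reasoning

2∤geometricSum⇒2∣exponent : ∀ {q a} → ¬ 2 ∣ q → ¬ 2 ∣ geometricSum q a → 2 ∣ a
2∤geometricSum⇒2∣exponent {q} {a} 2∤q 2∤sum = parity≡0ℙ⇒2∣ a (begin
  parity a                    ≡⟨ suc-homo-⁻¹ a ⟨
  parity (suc a) ⁻¹           ≡⟨ cong _⁻¹ (parity-geometricSum (¬2∣⇒parity≡1ℙ 2∤q) a) ⟨
  parity (geometricSum q a) ⁻¹ ≡⟨ cong _⁻¹ (¬2∣⇒parity≡1ℙ 2∤sum) ⟩
  0ℙ                          ∎)
  where open ≡-Reasoning

2∣2^ : ∀ n .{{_ : NonZero n}} → 2 ∣ 2 ^ n
2∣2^ (suc n) = m∣m*n (2 ^ n)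

2∤F : ∀ k → ¬ 2 ∣ F k
2∤F k 2∣F with ∣1⇒≡1 (∣m+n∣m⇒∣n 2∣F (2∣2^ (2 ^ k) {{m^n≢0 2 k}}))
... | ()

data Decreasing (n : ℕ) : List ℕ → Set where
  []   : Decreasing n []
  cons : ∀ {d ds} → 0 < d → d ≤ n → Decreasing (pred d) ds → Decreasing n (d ∷ ds)

sum≤sumTo : ∀ n {ds f} → Decreasing n ds → All (λ d → d ≤ f d) ds → sum ds ≤ sumTo n f
sum≤sumTo n       [] [] = z≤n
sum≤sumTo zero    (cons 0<d d≤0 _) _ = contradiction d≤0 (<⇒≱ 0<d)
sum≤sumTo (suc n) {d ∷ ds} {f} (cons 0<d d≤1+n rest) (d≤fd ∷ rest≤f) with d ≟ suc n
... | yes refl = subst (_≤ sumTo n f + f d) (+-comm (sum ds) d) (+-mono-≤ (sum≤sumTo n rest rest≤f) d≤fd)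
... | no  d≢1+n =
  ≤-trans (sum≤sumTo n (cons 0<d (≤-pred (≤∧≢⇒< d≤1+n d≢1+n)) rest) (d≤fd ∷ rest≤f)) (m≤m+n (sumTo n f) _)

sum≤σ : ∀ {n ds} → Decreasing n ds → All (_∣ n) ds → sum ds ≤ σ n
sum≤σ {n} dec divs = subst (_ ≤_) (sym (σ≡sumTo n)) (sum≤sumTo n dec (All.map d≤ifDivides divs))
  where
  d≤ifDivides : ∀ {d} → d ∣ n → d ≤ ifDivides n d
  d≤ifDivides d∣n = ≤-reflexive (sym (restrictTo-∈ (_∣? n) id d∣n))

18t<σ[10t] : ∀ {t} → 1 < t → 18 * t < σ (10 * t)
18t<σ[10t] {t} 1<t = subst (_≤ σ (10 * t)) (sum≡ t) (sum≤σ decreasing allDivide)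
  where
  sum≡ : ∀ t → 10 * t + (5 * t + (2 * t + (t + (1 + 0)))) ≡ suc (18 * t)
  sum≡ = solve-∀
  instance _ = >-nonZero (<-trans z<s 1<t)
  positive : ∀ c .{{_ : NonZero c}} → 0 < c * t
  positive c = >-nonZero⁻¹ (c * t) {{m*n≢0 c t}}
  below : ∀ a b → T (a <ᵇ b) → a * t ≤ pred (b * t)
  below a b a<b = <⇒≤pred (*-monoˡ-< t (<ᵇ⇒< a b a<b))
  decreasing : Decreasing (10 * t) (10 * t ∷ 5 * t ∷ 2 * t ∷ t ∷ 1 ∷ [])
  decreasing =
    cons (positive 10) ≤-refl (cons (positive 5) (below 5 10 _) (cons (positive 2) (below 2 5 _)
      (cons (<-trans z<s 1<t) (subst (_≤ pred (2 * t)) (*-identityˡ t) (below 1 2 _)) (cons z<s (<⇒≤pred 1<t) []))))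
  allDivide : All (_∣ 10 * t) (10 * t ∷ 5 * t ∷ 2 * t ∷ t ∷ 1 ∷ [])
  allDivide =
    ∣-refl ∷ *-monoˡ-∣ {5} {10} t (divides 2 refl) ∷ *-monoˡ-∣ {2} {10} t (divides 5 refl) ∷ n∣m*n 10 ∷ 1∣ _ ∷ []

prime∤! : ∀ {p m} → Prime p → m < p → ¬ p ∣ m !
prime∤! {m = zero}  pp _   = prime∤1 pp
prime∤! {m = suc m} pp m<p p∣ with euclidsLemma (suc m) (m !) pp p∣
... | inj₁ p∣1+m = <⇒≱ m<p (∣⇒≤ p∣1+m)
... | inj₂ p∣m!  = prime∤! pp (<-trans (n<1+n m) m<p) p∣m!

nCk*k!*[n∸k]!≡n! : ∀ {n k} → k ≤ n → (n C k) * (k ! * (n ∸ k) !) ≡ n !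
nCk*k!*[n∸k]!≡n! {n} {k} k≤n =
  trans (cong (_* (k ! * (n ∸ k) !)) (nCk≡n!/k![n-k]! k≤n)) (m/n*n≡m {{k !* (n ∸ k) !≢0}} (k![n∸k]!∣n! k≤n))

prime∣pCk : ∀ {p k} → Prime p → 0 < k → k < p → p ∣ (p C k)
prime∣pCk {p@(suc p-1)} {k} pp 0<k k<p
  with euclidsLemma (p C k) (k ! * (p ∸ k) !) pp (subst (p ∣_) (sym (nCk*k!*[n∸k]!≡n! (<⇒≤ k<p))) (m∣m*n (p-1 !)))
... | inj₁ p∣pCk = p∣pCk
... | inj₂ p∣k!*[p∸k]! with euclidsLemma (k !) ((p ∸ k) !) pp p∣k!*[p∸k]!
...   | inj₁ p∣k!     = contradiction p∣k! (prime∤! pp k<p)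
...   | inj₂ p∣[p∸k]! = contradiction p∣[p∸k]! (prime∤! pp (∸-monoʳ-< 0<k (<⇒≤ k<p)))

infix 4 _≡_mod_
_≡_mod_ : ℕ → ℕ → (n : ℕ) → .{{NonZero n}} → Set
_≡_mod_ a b n = a % n ≡ b % n

module _ {n : ℕ} .{{_ : NonZero n}} where

  +-cong-mod : ∀ {a b c d} → a ≡ b mod n → c ≡ d mod n → a + c ≡ b + d mod n
  +-cong-mod {a} {b} {c} {d} a≡b c≡d = begin
    (a + c) % n              ≡⟨ %-distribˡ-+ a c n ⟩
    (a % n + c % n) % n      ≡⟨ cong₂ (λ x y → (x + y) % n) a≡b c≡d ⟩
    (b % n + d % n) % n      ≡⟨ %-distribˡ-+ b d n ⟨
    (b + d) % n              ∎
    where open ≡-Reasoning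

  *-cong-mod : ∀ {a b c d} → a ≡ b mod n → c ≡ d mod n → a * c ≡ b * d mod n
  *-cong-mod {a} {b} {c} {d} a≡b c≡d = begin
    (a * c) % n              ≡⟨ %-distribˡ-* a c n ⟩
    (a % n * (c % n)) % n    ≡⟨ cong₂ (λ x y → (x * y) % n) a≡b c≡d ⟩
    (b % n * (d % n)) % n    ≡⟨ %-distribˡ-* b d n ⟨
    (b * d) % n              ∎
    where open ≡-Reasoning

  ^-cong-mod : ∀ {a b} → a ≡ b mod n → ∀ k → a ^ k ≡ b ^ k mod n
  ^-cong-mod a≡b zero    = refl
  ^-cong-mod a≡b (suc k) = *-cong-mod a≡b (^-cong-mod a≡b k)

  mod⇒∣∸ : ∀ {a b} → a ≡ b mod n → n ∣ a ∸ b
  mod⇒∣∸ {a} {b} a≡b = divides (a / n ∸ b / n) (begin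
    a ∸ b                                    ≡⟨ cong₂ _∸_ (m≡m%n+[m/n]*n a n) (m≡m%n+[m/n]*n b n) ⟩
    (a % n + a / n * n) ∸ (b % n + b / n * n) ≡⟨ cong (λ r → (r + a / n * n) ∸ (b % n + b / n * n)) a≡b ⟩
    (b % n + a / n * n) ∸ (b % n + b / n * n) ≡⟨ [m+n]∸[m+o]≡n∸o (b % n) _ _ ⟩
    a / n * n ∸ b / n * n                    ≡⟨ *-distribʳ-∸ n (a / n) (b / n) ⟨
    (a / n ∸ b / n) * n                      ∎)
    where open ≡-Reasoning

  ∣∸⇒mod : ∀ {a b} → b ≤ a → n ∣ a ∸ b → a ≡ b mod n
  ∣∸⇒mod {a} {b} b≤a n∣a∸b = trans (cong (_% n) (sym (m+[n∸m]≡n b≤a))) (%-remove-+ʳ b n∣a∸b)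

  *-cancelˡ-mod-prime : ∀ {c a b} → Prime n → ¬ n ∣ c → c * a ≡ c * b mod n → a ≡ b mod n
  *-cancelˡ-mod-prime {c} {a} {b} pn n∤c ca≡cb =
    [ (λ b≤a → cancel b≤a ca≡cb) , (λ a≤b → sym (cancel a≤b (sym ca≡cb))) ]′ (≤-total b a)
    where
    cancel : ∀ {x y} → y ≤ x → c * x ≡ c * y mod n → x ≡ y mod n
    cancel {x} {y} y≤x cx≡cy
      with euclidsLemma c (x ∸ y) pn (subst (n ∣_) (sym (*-distribˡ-∸ c x y)) (mod⇒∣∸ cx≡cy))
    ... | inj₁ n∣c   = contradiction n∣c n∤c
    ... | inj₂ n∣x∸y = ∣∸⇒mod y≤x n∣x∸y

  -- With a = 2s, the claim for q² gives q² ≡ 1, and then q ≡ q (q²)^s = q^(1+a) ≡ 1.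
  ^2^m≡1∧^odd≡1⇒≡1 : ∀ m {q a} → q ^ (2 ^ m) ≡ 1 mod n → 2 ∣ a → q ^ suc a ≡ 1 mod n → q ≡ 1 mod n
  ^2^m≡1∧^odd≡1⇒≡1 zero {q} q^1≡1 _ _ = trans (cong (_% n) (sym (*-identityʳ q))) q^1≡1
  ^2^m≡1∧^odd≡1⇒≡1 (suc m) {q} {a} q^2^[1+m]≡1 2∣a@(divides s refl) q^[1+a]≡1 = begin
    q % n                    ≡⟨ cong (_% n) (*-identityʳ q) ⟨
    (q * 1) % n              ≡⟨ *-cong-mod {a = q} refl (trans (^-cong-mod q²≡1 s) (cong (_% n) (^-zeroˡ s))) ⟨
    (q * (q ^ 2) ^ s) % n    ≡⟨ cong (λ x → (q * x) % n) (trans (^-*-assoc q 2 s) (cong (q ^_) (*-comm 2 s))) ⟩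
    q ^ suc a % n            ≡⟨ q^[1+a]≡1 ⟩
    1 % n                    ∎
    where
    open ≡-Reasoning
    ^-swap : ∀ x y → (q ^ x) ^ y ≡ (q ^ y) ^ x
    ^-swap x y = trans (^-*-assoc q x y) (trans (cong (q ^_) (*-comm x y)) (sym (^-*-assoc q y x)))
    q²≡1 : q ^ 2 ≡ 1 mod n
    q²≡1 = ^2^m≡1∧^odd≡1⇒≡1 m
      (trans (cong (_% n) (^-*-assoc q 2 (2 ^ m))) q^2^[1+m]≡1)
      2∣a
      (trans (cong (_% n) (^-swap 2 (suc a))) (^-cong-mod q^[1+a]≡1 2))

  ∣geometricSum⇒^≡1 : ∀ {q a} .{{_ : NonZero q}} → n ∣ geometricSum q a → q ^ suc a ≡ 1 mod n
  ∣geometricSum⇒^≡1 {suc t} {a} n∣sum =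
    trans (cong (_% n) (sym (geometricSum*pred+1≡^ t a))) (%-remove-+ˡ 1 (∣m⇒∣m*n t n∣sum))

∣-∑ : ∀ {d n} (f : Vector ℕ n) → (∀ i → d ∣ f i) → d ∣ ∑ f
∣-∑ {d} {zero}  f _   = d ∣0
∣-∑ {d} {suc n} f d∣f = ∣m∣n⇒∣m+n (d∣f Fin.zero) (∣-∑ (tail f) (d∣f ∘ Fin.suc))

×ₛ≡* : ∀ m n → m ×ₛ n ≡ m * n
×ₛ≡* zero    n = refl
×ₛ≡* (suc m) n = cong (n +_) (×ₛ≡* m n)

^ₛ≡^ : ∀ m n → m ^ₛ n ≡ m ^ n
^ₛ≡^ m zero    = refl
^ₛ≡^ m (suc n) = cong (m *_) (^ₛ≡^ m n)

binomial-+1 : ∀ n a → (a + 1) ^ suc n ≡ 1 + ∑ (λ (i : Fin n) → (suc n C suc (toℕ i)) * a ^ suc (toℕ i)) + a ^ suc n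
binomial-+1 n a = begin
  (a + 1) ^ suc n                                  ≡⟨ ^ₛ≡^ (a + 1) (suc n) ⟨
  (a + 1) ^ₛ suc n                                 ≡⟨ theorem (suc n) a 1 ⟩
  ∑ (binomialTerm a 1 (suc n))                     ≡⟨ ∑-cong-≗ {suc (suc n)} term ⟩
  1 + ∑ (tail t)                                   ≡⟨ cong (1 +_) (∑-init-last (tail t)) ⟩
  1 + (∑ (init (tail t)) + last (tail t))          ≡⟨ cong (λ x → 1 + (x + last (tail t))) (∑-cong-≗ {n} (cong t′ ∘ toℕ-inject₁)) ⟩
  1 + (∑ inner + last (tail t))                    ≡⟨ cong (λ x → 1 + (∑ inner + x)) top ⟩
  1 + (∑ inner + a ^ suc n)                        ≡⟨ +-assoc 1 (∑ inner) (a ^ suc n) ⟨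
  1 + ∑ inner + a ^ suc n                          ∎
  where
  open ≡-Reasoning
  t : Fin (suc (suc n)) → ℕ
  t k = (suc n C toℕ k) * a ^ toℕ k
  t′ : ℕ → ℕ
  t′ j = (suc n C suc j) * a ^ suc j
  inner : Vector ℕ n
  inner = t′ ∘ toℕ
  term : ∀ k → binomialTerm a 1 (suc n) k ≡ t k
  term k = begin
    binomialTerm a 1 (suc n) k                   ≡⟨ ×ₛ≡* (suc n C i) _ ⟩
    (suc n C i) * (a ^ₛ i * 1 ^ₛ (suc n ∸ i))     ≡⟨ cong (λ x → (suc n C i) * (x * 1 ^ₛ (suc n ∸ i))) (^ₛ≡^ a i) ⟩
    (suc n C i) * (a ^ i * 1 ^ₛ (suc n ∸ i))      ≡⟨ cong (λ x → (suc n C i) * (a ^ i * x)) 1^ₛ≡1 ⟩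
    (suc n C i) * (a ^ i * 1)                    ≡⟨ cong ((suc n C i) *_) (*-identityʳ (a ^ i)) ⟩
    t k                                          ∎
    where
    i = toℕ k
    1^ₛ≡1 : 1 ^ₛ (suc n ∸ i) ≡ 1
    1^ₛ≡1 = trans (^ₛ≡^ 1 (suc n ∸ i)) (^-zeroˡ (suc n ∸ i))
  top : last (tail t) ≡ a ^ suc n
  top = begin
    t′ (toℕ (fromℕ n))           ≡⟨ cong t′ (toℕ-fromℕ n) ⟩
    (suc n C suc n) * a ^ suc n  ≡⟨ cong (_* a ^ suc n) (nCn≡1 (suc n)) ⟩
    1 * a ^ suc n                ≡⟨ *-identityˡ _ ⟩
    a ^ suc n                    ∎

freshman's-dream : ∀ {p} .{{_ : NonZero p}} → Prime p → ∀ a → (a + 1) ^ p ≡ a ^ p + 1 mod p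
freshman's-dream {p@(suc n)} pp a = begin
  (a + 1) ^ p % p                          ≡⟨ cong (_% p) (binomial-+1 n a) ⟩
  (1 + ∑ inner + a ^ p) % p                ≡⟨ cong (_% p) (shuffle 1 (∑ inner) (a ^ p)) ⟩
  (∑ inner + (a ^ p + 1)) % p              ≡⟨ %-remove-+ˡ (a ^ p + 1) (∣-∑ inner p∣inner) ⟩
  (a ^ p + 1) % p                          ∎
  where
  open ≡-Reasoning
  inner : Vector ℕ n
  inner i = (p C suc (toℕ i)) * a ^ suc (toℕ i)
  p∣inner : ∀ i → p ∣ inner i
  p∣inner i = ∣m⇒∣m*n (a ^ suc (toℕ i)) (prime∣pCk pp z<s (s<s (toℕ<n i)))
  shuffle : ∀ x y z → x + y + z ≡ y + (z + x)
  shuffle = solve-∀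

fermat : ∀ {p} .{{_ : NonZero p}} → Prime p → ∀ a → a ^ p ≡ a mod p
fermat {zero}  pp _       = contradiction pp ¬prime[0]
fermat {suc _} pp zero    = refl
fermat {p}     pp (suc a) = begin
  suc a ^ p % p      ≡⟨ cong (λ x → x ^ p % p) (+-comm 1 a) ⟩
  (a + 1) ^ p % p    ≡⟨ freshman's-dream pp a ⟩
  (a ^ p + 1) % p    ≡⟨ +-cong-mod (fermat pp a) refl ⟩
  (a + 1) % p        ≡⟨ cong (_% p) (+-comm a 1) ⟩
  suc a % p          ∎
  where open ≡-Reasoning

fermat-∤ : ∀ {p a} .{{_ : NonZero p}} → Prime p → ¬ p ∣ a → a ^ (p ∸ 1) ≡ 1 mod p
fermat-∤ {suc p-1} {a} pp p∤a =
  *-cancelˡ-mod-prime pp p∤a (trans (fermat pp a) (cong (_% suc p-1) (sym (*-identityʳ a))))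

fermatPrime∤geometricSum : ∀ k {q a} → Prime (F k) → ¬ 2 ∣ q → ¬ 2 ∣ geometricSum q a →
                           ¬ 2 * F k ∣ q ∸ 1 → ¬ F k ∣ geometricSum q a
fermatPrime∤geometricSum k {q} {a} pF 2∤q 2∤sum 2F∤q∸1 F∣sum with F k ∣? q
... | yes F∣q = prime∤1 pF (∣q∧∣geometricSum⇒∣1 a F∣q F∣sum)
... | no  F∤q = 2F∤q∸1 (2∤m∧m∣x∧2∣x⇒2*m∣x (2∤F k) (mod⇒∣∸ q≡1) (2∤⇒2∣pred 2∤q))
  where
  instance
    _ = prime⇒nonZero pF
    _ = ≢-nonZero {q} (λ { refl → 2∤q (2 ∣0) })
  q^[F∸1]≡1 : q ^ (2 ^ 2 ^ k) ≡ 1 mod F k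
  q^[F∸1]≡1 = trans (cong (λ e → q ^ e % F k) (sym (m+n∸n≡m (2 ^ 2 ^ k) 1))) (fermat-∤ pF F∤q)
  q≡1 : q ≡ 1 mod F k
  q≡1 = ^2^m≡1∧^odd≡1⇒≡1 (2 ^ k) q^[F∸1]≡1
          (2∤geometricSum⇒2∣exponent {q} {a} 2∤q 2∤sum) (∣geometricSum⇒^≡1 {q = q} {a} F∣sum)

∃prime∣ : ∀ {n} → 1 < n → Σ[ p ∈ ℕ ] Prime p × p ∣ n
∃prime∣ {n} 1<n with factorise n {{>-nonZero (<-trans z<s 1<n)}}
... | record { factors = [] ; isFactorisation = n≡1 } = contradiction n≡1 (>⇒≢ 1<n)
... | record { factors = p ∷ ps ; isFactorisation = n≡p*∏ps ; factorsPrime = pp ∷ _ } =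
  p , pp , subst (p ∣_) (sym n≡p*∏ps) (m∣m*n (product ps))

factor-out : ∀ {q} → 1 < q → ∀ n → .{{_ : NonZero n}} → Σ[ a ∈ ℕ ] Σ[ m ∈ ℕ ] n ≡ q ^ a * m × ¬ q ∣ m
factor-out {q} 1<q = <-rec (λ n → .{{NonZero n}} → Σ[ a ∈ ℕ ] Σ[ m ∈ ℕ ] n ≡ q ^ a * m × ¬ q ∣ m) step
  where
  instance _ = n>1⇒nonTrivial 1<q
  step : ∀ n → (∀ {c} → c < n → .{{NonZero c}} → Σ[ a ∈ ℕ ] Σ[ m ∈ ℕ ] c ≡ q ^ a * m × ¬ q ∣ m) →
         .{{NonZero n}} → Σ[ a ∈ ℕ ] Σ[ m ∈ ℕ ] n ≡ q ^ a * m × ¬ q ∣ m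
  step n rec with q ∣? n
  ... | no  q∤n = 0 , n , sym (*-identityˡ n) , q∤n
  ... | yes q∣n with rec (quotient-< q∣n) {{quotient≢0 q∣n}}
  ...   | a , m , c≡q^a*m , q∤m =
    suc a , m , trans (m∣n⇒n≡m*quotient q∣n) (trans (cong (q *_) c≡q^a*m) (sym (*-assoc q (q ^ a) m))) , q∤m

prime-power-induction : (P : ℕ → Set) → P 1 →
                        (∀ {q a m} → Prime q → ¬ q ∣ m → .{{_ : NonZero m}} → P m → P (q ^ suc a * m)) →
                        ∀ n → .{{_ : NonZero n}} → P n
prime-power-induction P P1 step = <-rec (λ n → .{{NonZero n}} → P n) go
  where
  go : ∀ n → (∀ {m} → m < n → .{{NonZero m}} → P m) → .{{NonZero n}} → P n
  go 1 _ = P1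
  go n@(suc (suc _)) rec with ∃prime∣ {n} (s<s z<s)
  ... | q , pq , q∣n with factor-out (prime>1 pq) n
  ...   | zero  , m , n≡m , q∤m = contradiction (subst (q ∣_) (trans n≡m (*-identityˡ m)) q∣n) q∤m
  ...   | suc a , m , n≡q^[1+a]*m , q∤m = subst P (sym n≡q^[1+a]*m) (step {q} {a} pq q∤m (rec m<n))
    where
    instance
      _ = ≢-nonZero {m} (λ { refl → q∤m (q ∣0) })
      _ = prime⇒nonZero pq
      _ = m^n≢0 q a
    m<n : m < n
    m<n = subst (m <_) (trans (*-comm m _) (sym n≡q^[1+a]*m))
                (m<m*n m (q ^ suc a) (<-≤-trans (prime>1 pq) (m≤m*n q (q ^ a))))

fermatPrime∤σ : ∀ k → Prime (F k) → ∀ n → .{{_ : NonZero n}} → ¬ 2 ∣ n → ¬ 2 ∣ σ n →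
                (∀ {q} → Prime q → q ∣ n → ¬ 2 * F k ∣ q ∸ 1) → ¬ F k ∣ σ n
fermatPrime∤σ k pF = prime-power-induction P (λ _ _ _ → prime∤1 pF) (λ {q a m} → step {q} {a} {m})
  where
  P : ℕ → Set
  P n = ¬ 2 ∣ n → ¬ 2 ∣ σ n → (∀ {q} → Prime q → q ∣ n → ¬ 2 * F k ∣ q ∸ 1) → ¬ F k ∣ σ n
  step : ∀ {q a m} → Prime q → ¬ q ∣ m → .{{_ : NonZero m}} → P m → P (q ^ suc a * m)
  step {q} {a} {m} pq q∤m ih 2∤n 2∤σn noneOf =
    [ fermatPrime∤geometricSum k {q} {suc a} pF (divisor-2∤ q∣n 2∤n) (divisor-2∤ sum∣σn 2∤σn) (noneOf pq q∣n)
    , ih (divisor-2∤ m∣n 2∤n) (divisor-2∤ σm∣σn 2∤σn) (λ pq′ q′∣m → noneOf pq′ (∣-trans q′∣m m∣n))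
    ]′ ∘ euclidsLemma (geometricSum q (suc a)) (σ m) pF ∘ subst (F k ∣_) σn≡
    where
    σn≡ : σ (q ^ suc a * m) ≡ geometricSum q (suc a) * σ m
    σn≡ = σ[p^a*m]≡geometricSum*σ[m] pq q∤m (suc a)
    q∣n : q ∣ q ^ suc a * m
    q∣n = ∣m⇒∣m*n m (m∣m*n {q} (q ^ a))
    m∣n : m ∣ q ^ suc a * m
    m∣n = n∣m*n (q ^ suc a)
    sum∣σn : geometricSum q (suc a) ∣ σ (q ^ suc a * m)
    sum∣σn = subst (_ ∣_) (sym σn≡) (m∣m*n (σ m))
    σm∣σn : σ m ∣ σ (q ^ suc a * m)
    σm∣σn = subst (_ ∣_) (sym σn≡) (n∣m*n (geometricSum q (suc a)))

I≡9/5⇒n≡5g∧σ≡9g : ∀ n .{{_ : NonZero n}} → I n ≡ ℤ.+ 9 ℚ./ 5 → Σ[ g ∈ ℕ ] n ≡ 5 * g × σ n ≡ 9 * g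
I≡9/5⇒n≡5g∧σ≡9g n I≡9/5 =
  g , scaled (↧-/ (ℤ.+ σ n) n) (cong ℚ.↧_ I≡9/5) , scaled (↥-/ (ℤ.+ σ n) n) (cong ℚ.↥_ I≡9/5)
  where
  g = gcd (σ n) n
  scaled : ∀ {x c r} → x ℤ.* ℤ.+ g ≡ ℤ.+ c → x ≡ ℤ.+ r → c ≡ r * g
  scaled {r = r} x*g≡c refl = sym (ℤ.+-injective (trans (ℤ.pos-* r g) x*g≡c))

σ≡9g⇒2∤g : ∀ {N g} → 10 < N → N ≡ 5 * g → σ N ≡ 9 * g → ¬ 2 ∣ g
σ≡9g⇒2∤g {N} 10<N N≡5g σN≡9g (divides t refl) = <-irrefl (sym σ[10t]≡18t) (18t<σ[10t] 1<t)
  where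
  N≡10t : N ≡ 10 * t
  N≡10t = trans N≡5g (5*[t*2]≡10*t t)
    where
    5*[t*2]≡10*t : ∀ t → 5 * (t * 2) ≡ 10 * t
    5*[t*2]≡10*t = solve-∀
  σ[10t]≡18t : σ (10 * t) ≡ 18 * t
  σ[10t]≡18t = trans (cong σ (sym N≡10t)) (trans σN≡9g (9*[t*2]≡18*t t))
    where
    9*[t*2]≡18*t : ∀ t → 9 * (t * 2) ≡ 18 * t
    9*[t*2]≡18*t = solve-∀
  1<t : 1 < t
  1<t = ≰⇒> (λ t≤1 → <⇒≱ 10<N (≤-trans (≤-reflexive N≡10t) (*-monoʳ-≤ 10 t≤1)))

friendOf10⇒¬all-prime-factors-≢1-mod-2F :
  ∀ {N} .{{_ : NonZero N}} → FriendOf10 N → ∀ k → Prime (F k) → F k ∣ N →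
  ¬ (∀ {q} → Prime q → q ∣ N → ¬ 2 * F k ∣ q ∸ 1)
friendOf10⇒¬all-prime-factors-≢1-mod-2F {N} (10<N , I≡9/5) k pF F∣N noneOf
  with g , N≡5g , σN≡9g ← I≡9/5⇒n≡5g∧σ≡9g N I≡9/5 =
  [ F∤5 , F∤g ]′ (euclidsLemma 5 g pF (subst (F k ∣_) N≡5g F∣N))
  where
  2∤g : ¬ 2 ∣ g
  2∤g = σ≡9g⇒2∤g 10<N N≡5g σN≡9g
  2∤σN : ¬ 2 ∣ σ N
  2∤σN = subst (¬_ ∘ (2 ∣_)) (sym σN≡9g) (2∤* (from-no (2 ∣? 9)) 2∤g)
  F∤σN : ¬ F k ∣ σ N
  F∤σN = fermatPrime∤σ k pF N (subst (¬_ ∘ (2 ∣_)) (sym N≡5g) (2∤* (from-no (2 ∣? 5)) 2∤g)) 2∤σN noneOf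
  F∤g : ¬ F k ∣ g
  F∤g F∣g = F∤σN (subst (F k ∣_) (sym σN≡9g) (∣n⇒∣m*n 9 F∣g))
  F∤5 : ¬ F k ∣ 5
  F∤5 F∣5 with prime⇒irreducible (from-yes (prime? 5)) F∣5
  ... | inj₁ F≡1 = ¬prime[1] (subst Prime F≡1 pF)
  ... | inj₂ F≡5 = 2∤σN (subst (2 ∣_) (sym σN≡6σg) (∣m⇒∣m*n (σ g) (divides 3 refl)))
    where
    instance _ = ≢-nonZero {g} (λ { refl → 2∤g (2 ∣0) })
    σN≡6σg : σ N ≡ 6 * σ g
    σN≡6σg = trans (cong σ (trans N≡5g (cong (_* g) (sym (*-identityʳ 5)))))
                   (σ[p^a*m]≡geometricSum*σ[m] (subst Prime F≡5 pF) (F∤g ∘ subst (_∣ g) (sym F≡5)) 1)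

bounded-¬¬∃⇒∃ : ∀ {P : ℕ → Set} → (∀ q → Dec (P q)) →
                ∀ {N} → (∀ {q} → P q → q ≤ N) → ¬ ¬ Σ ℕ P → Σ ℕ P
bounded-¬¬∃⇒∃ {P} P? {N} bound ¬¬∃ with any? (λ (i : Fin (suc N)) → P? (toℕ i))
... | yes (i , Pi) = toℕ i , Pi
... | no  ∄i = contradiction (λ (q , Pq) → ∄i (fromℕ< (s≤s (bound Pq)) , subst P (sym (toℕ-fromℕ< _)) Pq)) ¬¬∃

corollary1p6 : (N : ℕ) → .{{_ : NonZero N}} → FriendOf10 N → (k : ℕ) → Prime (F k) → F k ∣ N →
    Σ ℕ (λ p → Prime p × p ∣ N × (2 * F k) ∣ (p ∸ 1))
corollary1p6 N friend k pF F∣N =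
  bounded-¬¬∃⇒∃ (λ q → prime? q ×-dec q ∣? N ×-dec 2 * F k ∣? q ∸ 1) (λ (_ , q∣N , _) → ∣⇒≤ q∣N)
    (λ ∄p → friendOf10⇒¬all-prime-factors-≢1-mod-2F friend k pF F∣N
              (λ pq q∣N 2F∣q∸1 → ∄p (_ , pq , q∣N , 2F∣q∸1)))
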